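{- Let $G$ be a connected graph on $n\ge2$ vertices, and let $G+K_1$ be the join of $G$ with a single new vertex $v$. Then there exists a minimum zero forcing set $S$ of $G+K_1$ with $S\subseteq V(G)$.
   Context: Zero forcing: given a set $S$ of initially black vertices (others white), the color-change rule turns a white vertex black if it is the only white neighbor of some black vertex; $S$ is a zero forcing set if eventually all vertices become black; a minimum-size zero forcing set is called a forcing basis. The join $G+K_1$ is obtained by adding a vertex adjacent to all vertices of $G$. -}

module Defs where

open import Data.Nat using (ℕ; suc; _≤_)
open import Data.Bool using (Bool; true; false; T)
open import Data.Fin using (Fin; zero; suc)
open import Data.Fin.Subset using (Subset; _∈_; ∣_∣)
open import Data.Product using (_×_)
open import Relation.Binary.PropositionalEquality using (_≡_; _≢_)
open import Relation.Nullary using (¬_)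

record Graph (n : ℕ) : Set where
  field
    adj   : Fin n → Fin n → Bool
    sym   : ∀ u v → adj u v ≡ adj v u
    loopless : ∀ u → adj u u ≡ false

open Graph public

Adj : ∀ {n} → Graph n → Fin n → Fin n → Set
Adj G u v = T (adj G u v)

data Walk {n : ℕ} (G : Graph n) : Fin n → Fin n → Set where
  here : ∀ {u} → Walk G u u
  step : ∀ {u v w} → Adj G u v → Walk G v w → Walk G u w

Connected : ∀ {n} → Graph n → Set
Connected G = ∀ u v → Walk G u v

-- Join G + K₁: new vertex is zero, vertex i of G becomes suc i.
joinAdj : ∀ {n} → Graph n → Fin (suc n) → Fin (suc n) → Bool
joinAdj G zero zero = false
joinAdj G zero (suc _) = true
joinAdj G (suc _) zero = true
joinAdj G (suc u) (suc v) = adj G u v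

joinSym : ∀ {n} (G : Graph n) u v → joinAdj G u v ≡ joinAdj G v u
joinSym G zero zero = _≡_.refl
joinSym G zero (suc _) = _≡_.refl
joinSym G (suc _) zero = _≡_.refl
joinSym G (suc u) (suc v) = sym G u v

joinLoopless : ∀ {n} (G : Graph n) u → joinAdj G u u ≡ false
joinLoopless G zero = _≡_.refl
joinLoopless G (suc u) = loopless G u

join-K₁ : ∀ {n} → Graph n → Graph (suc n)
join-K₁ G = record { adj = joinAdj G ; sym = joinSym G ; loopless = joinLoopless G }

-- Vertices eventually coloured black by repeated application of the colour-change
-- rule starting from the black set S (least set containing S closed under forcing):
-- if u is black and w is the only neighbour of u that is not (yet) black, w turns black.
data Black {n : ℕ} (G : Graph n) (S : Subset n) : Fin n → Set where
  initial : ∀ {x} → x ∈ S → Black G S x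
  force   : ∀ {u w} → Black G S u → Adj G u w →
            (∀ y → Adj G u y → y ≢ w → Black G S y) → Black G S w

IsZeroForcingSet : ∀ {n} → Graph n → Subset n → Set
IsZeroForcingSet G S = ∀ x → Black G S x

IsForcingBasis : ∀ {n} → Graph n → Subset n → Set
IsForcingBasis G S =
  IsZeroForcingSet G S × (∀ T' → IsZeroForcingSet G T' → ∣ S ∣ ≤ ∣ T' ∣)

-- Take a forcing basis S of G + K₁ that contains the apex. If S contains all of G, the apex
-- can simply be dropped. Otherwise look at the first force u → w of a chronological list:
-- in (S − apex) ∪ {w} all neighbours of u in G are black, so u (or, when u is the apex
-- itself, any vertex of G) forces the apex, and afterwards everything S forces is forced.
-- Forcing bases exist because being a zero forcing set is decidable.
module Submission where

open import Defs
open import Data.Nat using (ℕ; _≤_)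
open import Data.Fin using (zero)
open import Data.Fin.Subset using (Subset; _∉_)
open import Data.Product using (Σ; _×_)

open import Data.Empty using (⊥-elim)
open import Data.Fin using (Fin; suc; _≟_)
open import Data.Fin.Properties using (any?; all?)
open import Data.Fin.Subset using (_∈_; ∣_∣; ⊤; ⁅_⁆; _∪_; inside; outside)
open import Data.Fin.Subset.Properties
  using (_∈?_; anySubset?; ∈⊤; ∣p∣≤n; p⊂q⇒∣p∣<∣q∣; ∣⁅x⁆∣≡1; x∈⁅x⁆; x∈⁅y⁆⇒x≡y; p⊆p∪q; q⊆p∪q; x∈p∪q⁻)
open import Data.Nat using (zero; suc; _+_; _<_; z≤n; s≤s)
open import Data.Nat.Properties
  using (≤-trans; <-≤-trans; +-suc; +-monoʳ-≤; m≤m+n; n≤1+n; <⇒≱; ≮⇒≥; _<?_; ≤-pred)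
open import Data.Product using (∃; _,_)
open import Data.Sum using (inj₁; inj₂)
open import Data.Unit using (tt)
open import Data.Vec using ([]; _∷_; here; there)
open import Relation.Binary.PropositionalEquality as ≡ using (refl; _≢_; subst)
open import Relation.Nullary using (Dec; yes; no)
open import Relation.Nullary.Decidable using (map′; decidable-stable; ¬?; _×-dec_; _→-dec_; T?)
open import Relation.Unary using (Decidable)

∣p∪q∣≤∣p∣+∣q∣ : ∀ {m} (p q : Subset m) → ∣ p ∪ q ∣ ≤ ∣ p ∣ + ∣ q ∣
∣p∪q∣≤∣p∣+∣q∣ []            []            = z≤n
∣p∪q∣≤∣p∣+∣q∣ (inside  ∷ p) (inside  ∷ q) =
  s≤s (≤-trans (∣p∪q∣≤∣p∣+∣q∣ p q) (+-monoʳ-≤ ∣ p ∣ (n≤1+n ∣ q ∣)))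
∣p∪q∣≤∣p∣+∣q∣ (inside  ∷ p) (outside ∷ q) = s≤s (∣p∪q∣≤∣p∣+∣q∣ p q)
∣p∪q∣≤∣p∣+∣q∣ (outside ∷ p) (inside  ∷ q) =
  subst (suc ∣ p ∪ q ∣ ≤_) (≡.sym (+-suc ∣ p ∣ ∣ q ∣)) (s≤s (∣p∪q∣≤∣p∣+∣q∣ p q))
∣p∪q∣≤∣p∣+∣q∣ (outside ∷ p) (outside ∷ q) = ∣p∪q∣≤∣p∣+∣q∣ p q

∣⁅x⁆∪p∣≤1+∣p∣ : ∀ {m} (x : Fin m) (p : Subset m) → ∣ ⁅ x ⁆ ∪ p ∣ ≤ suc ∣ p ∣
∣⁅x⁆∪p∣≤1+∣p∣ x p = subst (λ k → ∣ ⁅ x ⁆ ∪ p ∣ ≤ k + ∣ p ∣) (∣⁅x⁆∣≡1 x) (∣p∪q∣≤∣p∣+∣q∣ ⁅ x ⁆ p)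

∣p∣<∣⁅x⁆∪p∣ : ∀ {m} {x : Fin m} {p : Subset m} → x ∉ p → ∣ p ∣ < ∣ ⁅ x ⁆ ∪ p ∣
∣p∣<∣⁅x⁆∪p∣ {x = x} {p} x∉p = p⊂q⇒∣p∣<∣q∣ (q⊆p∪q ⁅ x ⁆ p , x , p⊆p∪q p (x∈⁅x⁆ x) , x∉p)

minimalSubset : ∀ {m} {P : Subset m → Set} → Decidable P → ∀ k (S : Subset m) → P S → ∣ S ∣ ≤ k →
                Σ (Subset m) λ S → P S × (∀ T → P T → ∣ S ∣ ≤ ∣ T ∣)
minimalSubset P? zero    S PS ∣S∣≤0 = S , PS , λ T _ → ≤-trans ∣S∣≤0 z≤n
minimalSubset P? (suc k) S PS ∣S∣≤k+1 with anySubset? (λ T → P? T ×-dec (∣ T ∣ <? ∣ S ∣))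
... | yes (T , PT , ∣T∣<∣S∣) = minimalSubset P? k T PT (≤-pred (≤-trans ∣T∣<∣S∣ ∣S∣≤k+1))
... | no noSmaller          = S , PS , λ T PT → ≮⇒≥ (λ ∣T∣<∣S∣ → noSmaller (T , PT , ∣T∣<∣S∣))

module _ {m} (H : Graph m) where

  Forceable : Subset m → Fin m → Set
  Forceable S w = ∃ λ u → u ∈ S × Adj H u w × (∀ y → Adj H u y → y ≢ w → y ∈ S)

  forceable? : ∀ S w → Dec (Forceable S w)
  forceable? S w = any? λ u → (u ∈? S) ×-dec T? (adj H u w) ×-dec
    all? (λ y → T? (adj H u y) →-dec (¬? (y ≟ w) →-dec (y ∈? S)))

  Black-mono : ∀ {S S'} → (∀ x → x ∈ S → Black H S' x) → ∀ {x} → Black H S x → Black H S' x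
  Black-mono S⊆S' (initial x∈S)       = S⊆S' _ x∈S
  Black-mono S⊆S' (force bu u~w rest) =
    force (Black-mono S⊆S' bu) u~w (λ y u~y y≢w → Black-mono S⊆S' (rest y u~y y≢w))

  firstForce : ∀ {S x} → Black H S x → x ∉ S → ∃ λ w → w ∉ S × Forceable S w
  firstForce (initial x∈S) x∉S = ⊥-elim (x∉S x∈S)
  firstForce {S} (force {u} {w} bu u~w rest) w∉S with u ∈? S
  ... | no u∉S = firstForce bu u∉S
  ... | yes u∈S with any? (λ y → T? (adj H u y) ×-dec ¬? (y ≟ w) ×-dec ¬? (y ∈? S))
  ...   | yes (y , u~y , y≢w , y∉S) = firstForce (rest y u~y y≢w) y∉S
  ...   | no none = w , w∉S , u , u∈S , u~w ,
                    λ y u~y y≢w → decidable-stable (y ∈? S) (λ y∉S → none (y , u~y , y≢w , y∉S))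

  Black-⁅x⁆∪ : ∀ {S w} → Forceable S w → ∀ {x} → Black H (⁅ w ⁆ ∪ S) x → Black H S x
  Black-⁅x⁆∪ {S} {w} (u , u∈S , u~w , rest) = Black-mono inS+w
    where
    inS+w : ∀ x → x ∈ ⁅ w ⁆ ∪ S → Black H S x
    inS+w x x∈ with x∈p∪q⁻ ⁅ w ⁆ S x∈
    ... | inj₂ x∈S = initial x∈S
    ... | inj₁ x∈⁅w⁆ rewrite x∈⁅y⁆⇒x≡y w x∈⁅w⁆ =
      force (initial u∈S) u~w (λ y u~y y≢w → initial (rest y u~y y≢w))

  -- k bounds the number of white vertices, and each forcing step blackens one of them.
  black? : ∀ k S → m ≤ k + ∣ S ∣ → ∀ x → Dec (Black H S x)
  black? k S bound x with any? (λ w → ¬? (w ∈? S) ×-dec forceable? S w)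
  ... | no closed =
    map′ initial (λ bx → decidable-stable (x ∈? S) (λ x∉S → closed (firstForce bx x∉S))) (x ∈? S)
  ... | yes (w , w∉S , fw) = grow k bound
    where
    grow : ∀ k → m ≤ k + ∣ S ∣ → Dec (Black H S x)
    grow zero    bound = ⊥-elim (<⇒≱ (<-≤-trans (∣p∣<∣⁅x⁆∪p∣ w∉S) (∣p∣≤n (⁅ w ⁆ ∪ S))) bound)
    grow (suc k) bound = map′ (Black-⁅x⁆∪ fw) (Black-mono (λ y y∈S → initial (q⊆p∪q ⁅ w ⁆ S y∈S)))
      (black? k (⁅ w ⁆ ∪ S) (≤-trans bound (subst (_≤ k + ∣ ⁅ w ⁆ ∪ S ∣) (+-suc k ∣ S ∣)
                                                  (+-monoʳ-≤ k (∣p∣<∣⁅x⁆∪p∣ w∉S)))) x)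

  isZeroForcingSet? : ∀ S → Dec (IsZeroForcingSet H S)
  isZeroForcingSet? S = all? (black? m S (m≤m+n m ∣ S ∣))

  forcingBasis : Σ (Subset m) (IsForcingBasis H)
  forcingBasis = minimalSubset isZeroForcingSet? m ⊤ (λ _ → initial ∈⊤) (∣p∣≤n ⊤)

module _ {n} (G : Graph n) where

  apexBlack : ∀ {S} u → Black (join-K₁ G) S (suc u) →
              (∀ j → Adj G u j → Black (join-K₁ G) S (suc j)) → Black (join-K₁ G) S zero
  apexBlack u bu nbrs = force bu tt λ { zero _ 0≢0 → ⊥-elim (0≢0 refl) ; (suc j) u~j _ → nbrs j u~j }

  apexSwap : ∀ w r → Black (join-K₁ G) (outside ∷ (⁅ w ⁆ ∪ r)) zero →
             IsZeroForcingSet (join-K₁ G) (inside ∷ r) →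
             IsZeroForcingSet (join-K₁ G) (outside ∷ (⁅ w ⁆ ∪ r))
  apexSwap w r apex zfs x = Black-mono (join-K₁ G) S⊆Black (zfs x)
    where
    S⊆Black : ∀ y → y ∈ inside ∷ r → Black (join-K₁ G) (outside ∷ (⁅ w ⁆ ∪ r)) y
    S⊆Black zero    _           = apex
    S⊆Black (suc j) (there j∈r) = initial (there (q⊆p∪q ⁅ w ⁆ r j∈r))

  apexReplacement : Fin n → ∀ r → IsZeroForcingSet (join-K₁ G) (inside ∷ r) →
                    ∃ λ w → Black (join-K₁ G) (outside ∷ (⁅ w ⁆ ∪ r)) zero
  apexReplacement v r zfs with any? (λ x → ¬? (x ∈? (inside ∷ r)))
  ... | no allIn = v , apexBlack v (initial (inG v)) (λ j _ → initial (inG j))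
    where
    inG : ∀ j → suc j ∈ outside ∷ (⁅ v ⁆ ∪ r)
    inG j with suc j ∈? (inside ∷ r)
    ... | yes (there j∈r) = there (q⊆p∪q ⁅ v ⁆ r j∈r)
    ... | no  j∉S         = ⊥-elim (allIn (suc j , j∉S))
  ... | yes (x , x∉S) with firstForce (join-K₁ G) (zfs x) x∉S
  ...   | zero  , 0∉S , _                 = ⊥-elim (0∉S here)
  ...   | suc w , _   , u , u∈S , _ , rest = w , forced u u∈S rest
    where
    S' = outside ∷ (⁅ w ⁆ ∪ r)
    Rest : Fin (suc n) → Set
    Rest u = ∀ y → Adj (join-K₁ G) u y → y ≢ suc w → y ∈ inside ∷ r
    nbrIn : ∀ u → Rest u → ∀ j → Adj (join-K₁ G) u (suc j) → Black (join-K₁ G) S' (suc j)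
    nbrIn u rest j u~j with j ≟ w
    ... | yes refl = initial (there (p⊆p∪q r (x∈⁅x⁆ w)))
    ... | no j≢w  with rest (suc j) u~j (λ { refl → j≢w refl })
    ...   | there j∈r = initial (there (q⊆p∪q ⁅ w ⁆ r j∈r))
    forced : ∀ u → u ∈ inside ∷ r → Rest u → Black (join-K₁ G) S' zero
    forced zero     _            rest = apexBlack v (nbrIn zero rest v tt) (λ j _ → nbrIn zero rest j tt)
    forced (suc u') (there u'∈r) rest =
      apexBlack u' (initial (there (q⊆p∪q ⁅ w ⁆ r u'∈r))) (nbrIn (suc u') rest)

mainTheorem14 : (n : ℕ) → 2 ≤ n → (G : Graph n) → Connected G →
    Σ (Subset _) (λ S → IsForcingBasis (join-K₁ G) S × zero ∉ S)
mainTheorem14 (suc n) _ G _ with forcingBasis (join-K₁ G)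
... | outside ∷ r , basis = outside ∷ r , basis , λ ()
... | inside ∷ r , zfs , minimum with apexReplacement G zero r zfs
...   | w , apex = outside ∷ (⁅ w ⁆ ∪ r) ,
                   (apexSwap G w r apex zfs , λ T zfsT → ≤-trans (∣⁅x⁆∪p∣≤1+∣p∣ w r) (minimum T zfsT)) ,
                   λ ()
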